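{- Let $\alpha$ be a square-free positive rational number and let $0\le n<m\le N$. Suppose $\mathbf A$ is a factorization of $\alpha_n$ and $\mathbf B$ is a factorization of $\alpha_m$ with $\mathbf A<\mathbf B$. Then there is a unique tuple of factorizations $\mathbf A_{n+1},\dots,\mathbf A_{m-1}$ of $\alpha_{n+1},\dots,\alpha_{m-1}$, respectively, such that $\mathbf A<\mathbf A_{n+1}<\mathbf A_{n+2}<\cdots<\mathbf A_{m-1}<\mathbf B$, where each $<$ denotes direct subfactorization.
   Context: Write $\alpha=a/b$ with $a,b$ coprime positive integers; $\alpha$ is square-free if $a$ and $b$ are both square-free. Let $p_1\ge\cdots\ge p_N$ be the primes dividing $ab$, listed with multiplicity. Put $\gamma(i)=1$ if $p_i\mid a$, $\gamma(i)=-1$ if $p_i\mid b$, and $\alpha_n=\prod_{i=1}^n p_i^{\gamma(i)}$ for $0\le n\le N$. A factorization of a positive rational $\beta$ is a sequence $(a_1/b_1,a_2/b_2,\dots)$ with $a_i,b_i$ positive integers, $a_i=b_i=1$ for all but finitely many $i$, $\prod_i a_i/b_i=\beta$, $\max\{a_i,b_i\}\ge\max\{a_{i+1},b_{i+1}\}$ for all $i$, and $\gcd(a_i,b_j)=1$ for all $i,j$. For $0\le n<N$, a factorization $(a_i/b_i)$ of $\alpha_n$ is a direct subfactorization of a factorization $(c_i/d_i)$ of $\alpha_{n+1}$ if either $p_{n+1}\mid a$ and for some $k$: $d_i=b_i$ for all $i$, $c_i=a_i$ for $i\ne k$, $c_k=a_kp_{n+1}$; or $p_{n+1}\mid b$ and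 for some $k$: $c_i=a_i$ for all $i$, $d_i=b_i$ for $i\ne k$, $d_k=b_kp_{n+1}$. For $n<m$, a factorization $\mathbf A$ of $\alpha_n$ is a subfactorization of a factorization $\mathbf B$ of $\alpha_m$, written $\mathbf A<\mathbf B$, if there exist factorizations $\mathbf A_j$ of $\alpha_j$ ($n<j<m$) such that in the chain $\mathbf A,\mathbf A_{n+1},\dots,\mathbf A_{m-1},\mathbf B$ each term is a direct subfactorization of the next. -}

module Defs where

open import Data.Nat using (ℕ; zero; suc; _*_; _≤_; _<_; _⊔_)
open import Data.Nat.Divisibility using (_∣_; _∣?_)
open import Data.Nat.Coprimality using (Coprime)
open import Data.Product using (Σ; ∃; _×_; _,_; proj₁; proj₂)
open import Data.Sum using (_⊎_)
open import Data.Bool using (if_then_else_)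
open import Relation.Nullary using (¬_; does)
open import Relation.Binary.PropositionalEquality using (_≡_; _≢_)

SquareFree : ℕ → Set
SquareFree x = ∀ d → d * d ∣ x → d ≡ 1

prodTo : (ℕ → ℕ) → ℕ → ℕ
prodTo f zero    = 1
prodTo f (suc n) = prodTo f n * f n

-- A sequence of fractions (a_i / b_i), i = 0,1,2,...  (0-based indexing)
Seq : Set
Seq = ℕ → ℕ × ℕ

num den : Seq → ℕ → ℕ
num s i = proj₁ (s i)
den s i = proj₂ (s i)

IsFactorization : ℕ → ℕ → Seq → Set
IsFactorization u v s =
    (∀ i → 0 < num s i × 0 < den s i)
  × (Σ ℕ λ K → (∀ i → K ≤ i → s i ≡ (1 , 1))
             × (prodTo (num s) K * v ≡ prodTo (den s) K * u))
  × (∀ i → num s (suc i) ⊔ den s (suc i) ≤ num s i ⊔ den s i)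
  × (∀ i j → Coprime (num s i) (den s j))

-- α = a/b, primes p 0 ≥ p 1 ≥ ... ≥ p (N-1)  (p (i-1) is the paper's p_i).
-- α_n = numα a p n / denα b p n
numα : ℕ → (ℕ → ℕ) → ℕ → ℕ
numα a p = prodTo (λ i → if does (p i ∣? a) then p i else 1)

denα : ℕ → (ℕ → ℕ) → ℕ → ℕ
denα b p = prodTo (λ i → if does (p i ∣? b) then p i else 1)

FactOf : ℕ → ℕ → (ℕ → ℕ) → ℕ → Seq → Set
FactOf a b p n s = IsFactorization (numα a p n) (denα b p n) s

-- s (a factorization of α_n) is a direct subfactorization of
-- t (a factorization of α_{n+1}); the new prime is p n (paper's p_{n+1}).
DirectSub : ℕ → ℕ → (ℕ → ℕ) → ℕ → Seq → Seq → Set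
DirectSub a b p n s t =
    FactOf a b p n s
  × FactOf a b p (suc n) t
  × ( (p n ∣ a × Σ ℕ λ k → (∀ i → den t i ≡ den s i)
                         × (∀ i → i ≢ k → num t i ≡ num s i)
                         × num t k ≡ num s k * p n)
    ⊎ (p n ∣ b × Σ ℕ λ k → (∀ i → num t i ≡ num s i)
                         × (∀ i → i ≢ k → den t i ≡ den s i)
                         × den t k ≡ den s k * p n))

Chain : ℕ → ℕ → (ℕ → ℕ) → ℕ → ℕ → Seq → Seq → (ℕ → Seq) → Set
Chain a b p n m A B C =
    (∀ i → C n i ≡ A i)
  × (∀ i → C m i ≡ B i)
  × (∀ j → n ≤ j → j < m → DirectSub a b p j (C j) (C (suc j)))

SubFact : ℕ → ℕ → (ℕ → ℕ) → ℕ → ℕ → Seq → Seq → Set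
SubFact a b p n m A B = n < m × Σ (ℕ → Seq) (Chain a b p n m A B)

module Submission where

-- Existence is part of the hypothesis A < B, so the content is uniqueness.
-- The key observation: since α = a/b is square-free with a, b coprime, the
-- primes p 0, …, p (N-1) are pairwise distinct, so the prime p j added in
-- passing from α_j to α_{j+1} divides no numerator or denominator of any
-- factorization of α_j.  Hence if two direct subfactorizations of the same
-- factorization of α_{j+1} multiplied p j into entries k and k′, then k = k′
-- (otherwise p j would divide an entry below) and cancelling p j shows the
-- two subfactorizations coincide.  Uniqueness along a whole chain then
-- follows by downward induction from the common top B.

open import Defs
open import Data.Nat using (ℕ; zero; suc; z≤n; s≤s; z<s; _*_; _+_; _∸_; _≤_; _<_; NonZero)
open import Data.Nat.Base using (nonTrivial⇒≢1)
open import Data.Nat.Properties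
open import Data.Nat.Divisibility
open import Data.Nat.Coprimality using (Coprime)
import Data.Nat.Coprimality as Coprimality
open import Data.Nat.Primality using (Prime; prime; euclidsLemma; prime⇒irreducible; prime⇒nonZero)
open import Data.Bool using (Bool; true; false; if_then_else_)
open import Data.Product using (Σ; _×_; _,_; proj₁; proj₂)
open import Data.Sum using (_⊎_; inj₁; inj₂)
open import Data.Empty using (⊥; ⊥-elim)
open import Function using (_∘_)
open import Relation.Nullary using (¬_; yes; no; does)
open import Relation.Binary.PropositionalEquality

prime≢1 : ∀ {q} → Prime q → q ≢ 1
prime≢1 (prime _) = nonTrivial⇒≢1

prime∤1 : ∀ {q} → Prime q → ¬ q ∣ 1
prime∤1 q-prime = prime≢1 q-prime ∘ ∣1⇒≡1

prime∤common : ∀ {q x y} → Prime q → Coprime x y → q ∣ x → q ∣ y → ⊥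
prime∤common q-prime cop q∣x q∣y = prime≢1 q-prime (cop (q∣x , q∣y))

prodTo-prefix : ∀ f {K L} → K ≤ L → prodTo f K ∣ prodTo f L
prodTo-prefix f {L = zero} z≤n = ∣-refl
prodTo-prefix f {L = suc L} K≤1+L with m≤n⇒m<n∨m≡n K≤1+L
... | inj₁ (s≤s K≤L) = ∣m⇒∣m*n (f L) (prodTo-prefix f K≤L)
... | inj₂ refl = ∣-refl

factor∣prodTo : ∀ f {i K} → i < K → f i ∣ prodTo f K
factor∣prodTo f {i} i<K = ∣-trans (n∣m*n (prodTo f i)) (prodTo-prefix f i<K)

prime∣prodTo : ∀ {q} → Prime q → ∀ f K → q ∣ prodTo f K → Σ ℕ λ i → i < K × q ∣ f i
prime∣prodTo q-prime f zero q∣1 = ⊥-elim (prime∤1 q-prime q∣1)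
prime∣prodTo q-prime f (suc K) q∣prod with euclidsLemma (prodTo f K) (f K) q-prime q∣prod
... | inj₁ q∣prefix = let (i , i<K , q∣fi) = prime∣prodTo q-prime f K q∣prefix
                      in i , m<n⇒m<1+n i<K , q∣fi
... | inj₂ q∣last = K , n<1+n K , q∣last


-- Writing
-- x = c * q, q² ∣ x * y forces q ∣ c * y; but q ∣ c contradicts square-freeness
-- of x, and q ∣ y contradicts coprimality.
prime²∤product-via : ∀ {x y q} → Coprime x y → SquareFree x → Prime q → q ∣ x →
                     ¬ q * q ∣ x * y
prime²∤product-via {y = y} {q} cop sf-x q-prime q∣x@(divides c refl) q²∣xy
  with euclidsLemma c y q-prime (*-cancelˡ-∣ q {{prime⇒nonZero q-prime}} q²∣q[cy])
  where
    reassoc : c * q * y ≡ q * (c * y)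
    reassoc = begin
      c * q * y   ≡⟨ *-assoc c q y ⟩
      c * (q * y) ≡⟨ cong (c *_) (*-comm q y) ⟩
      c * (y * q) ≡⟨ *-assoc c y q ⟨
      c * y * q   ≡⟨ *-comm (c * y) q ⟩
      q * (c * y) ∎
      where open ≡-Reasoning

    q²∣q[cy] : q * q ∣ q * (c * y)
    q²∣q[cy] = subst (q * q ∣_) reassoc q²∣xy
... | inj₁ q∣c = prime≢1 q-prime (sf-x q (*-monoˡ-∣ q q∣c))
... | inj₂ q∣y = prime∤common q-prime cop q∣x q∣y

prime²∤coprime-product : ∀ {a b q} → Coprime a b → SquareFree a → SquareFree b →
                         Prime q → ¬ q * q ∣ a * b
prime²∤coprime-product {a} {b} {q} cop sf-a sf-b q-prime q²∣ab
  with euclidsLemma a b q-prime (∣-trans (m∣m*n q) q²∣ab)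
... | inj₁ q∣a = prime²∤product-via cop sf-a q-prime q∣a q²∣ab
... | inj₂ q∣b = prime²∤product-via (Coprimality.sym cop) sf-b q-prime q∣b
                   (subst (q * q ∣_) (*-comm a b) q²∣ab)

distinct-primes : ∀ p N → (∀ {q} → Prime q → ¬ q * q ∣ prodTo p N) →
                  ∀ {i j} → i < j → j < N → Prime (p j) → p i ≢ p j
distinct-primes p N square-free {i} {j} i<j j<N pj-prime pi≡pj =
  square-free pj-prime (subst (λ x → x * p j ∣ prodTo p N) pi≡pj pi*pj∣prod)
  where
    pi*pj∣prod : p i * p j ∣ prodTo p N
    pi*pj∣prod = ∣-trans (*-monoˡ-∣ (p j) (factor∣prodTo p i<j)) (prodTo-prefix p j<N)

-- g selects from p if each g i is either p i or 1 (as in the numerator and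
-- denominator of α_n, which keep exactly the primes dividing a, resp. b).
Selects : (ℕ → ℕ) → (ℕ → ℕ) → Set
Selects p g = ∀ i → g i ≡ p i ⊎ g i ≡ 1

selects-if : ∀ p (c : ℕ → Bool) → Selects p (λ i → if c i then p i else 1)
selects-if p c i with c i
... | true  = inj₁ refl
... | false = inj₂ refl

prime∤earlier-selection : ∀ p N → (∀ i → i < N → Prime (p i)) →
                          (∀ {i j} → i < j → j < N → p i ≢ p j) →
                          ∀ g → Selects p g → ∀ {j} → j < N → ¬ p j ∣ prodTo g j
prime∤earlier-selection p N primes distinct g selects {j} j<N pj∣prod
  with prime∣prodTo (primes j j<N) g j pj∣prod
... | i , i<j , pj∣gi with selects i
...   | inj₂ gi≡1 = prime∤1 (primes j j<N) (subst (p j ∣_) gi≡1 pj∣gi)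
...   | inj₁ gi≡pi with prime⇒irreducible (primes i (<-trans i<j j<N)) (subst (p j ∣_) gi≡pi pj∣gi)
...     | inj₁ pj≡1  = prime≢1 (primes j j<N) pj≡1
...     | inj₂ pj≡pi = distinct i<j j<N (sym pj≡pi)

prime∣cross-product : ∀ {q u v K} f g → Prime q → (∀ i′ → ¬ q ∣ g i′) →
                      prodTo f K * v ≡ prodTo g K * u →
                      ∀ {i} → i < K → q ∣ f i → q ∣ u
prime∣cross-product {q} {u} {v} {K} f g q-prime q∤g cross i<K q∣fi
  with euclidsLemma (prodTo g K) u q-prime
         (subst (q ∣_) cross (∣m⇒∣m*n v (∣-trans q∣fi (factor∣prodTo f i<K))))
... | inj₁ q∣prod-g = let (i′ , _ , q∣gi′) = prime∣prodTo q-prime g K q∣prod-g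
                      in ⊥-elim (q∤g i′ q∣gi′)
... | inj₂ q∣u = q∣u

-- In a factorization of u/v, every prime dividing a numerator divides u and
-- every prime dividing a denominator divides v (numerators and denominators
-- being coprime, such a prime cannot be cancelled).
prime∣num⇒∣ : ∀ {u v s q i} → IsFactorization u v s → Prime q → q ∣ num s i → q ∣ u
prime∣num⇒∣ {s = s} {i = i} (_ , (K , trivial , cross) , _ , cop) q-prime q∣num with i <? K
... | no i≮K = ⊥-elim (prime∤1 q-prime (subst (_ ∣_) (cong proj₁ (trivial i (≮⇒≥ i≮K))) q∣num))
... | yes i<K = prime∣cross-product (num s) (den s) q-prime
                  (λ i′ → prime∤common q-prime (cop i i′) q∣num) cross i<K q∣num

prime∣den⇒∣ : ∀ {u v s q i} → IsFactorization u v s → Prime q → q ∣ den s i → q ∣ v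
prime∣den⇒∣ {s = s} {i = i} (_ , (K , trivial , cross) , _ , cop) q-prime q∣den with i <? K
... | no i≮K = ⊥-elim (prime∤1 q-prime (subst (_ ∣_) (cong proj₂ (trivial i (≮⇒≥ i≮K))) q∣den))
... | yes i<K = prime∣cross-product (den s) (num s) q-prime
                  (λ i′ q∣num → prime∤common q-prime (cop i′ i) q∣num q∣den) (sym cross) i<K q∣den

-- y arises from x by multiplying the single entry k by q; this is the shape
-- of the changed side (numerators or denominators) in a direct subfactorization.
ScaledAt : ℕ → ℕ → (ℕ → ℕ) → (ℕ → ℕ) → Set
ScaledAt q k x y = (∀ i → i ≢ k → y i ≡ x i) × y k ≡ x k * q

-- If q (nonzero) divides no entry of x, then x is determined by any scaling of
-- it: the scaled positions must agree, since otherwise q would divide x k′,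
-- and at the common position q cancels.
scaledAt-unique : ∀ {q k k′ x x′ y y′} .{{_ : NonZero q}} → (∀ i → ¬ q ∣ x i) →
                  ScaledAt q k x y → ScaledAt q k′ x′ y′ → y ≗ y′ → x ≗ x′
scaledAt-unique {q} {k} {k′} {x} {x′} {y} {y′} q∤x (same , at) (same′ , at′) y≗y′ i
  with k ≟ k′
... | no k≢k′ = ⊥-elim (q∤x k′ (divides (x′ k′) x[k′]≡x′[k′]*q))
  where
    x[k′]≡x′[k′]*q : x k′ ≡ x′ k′ * q
    x[k′]≡x′[k′]*q = begin
      x k′      ≡⟨ same k′ (k≢k′ ∘ sym) ⟨
      y k′      ≡⟨ y≗y′ k′ ⟩
      y′ k′     ≡⟨ at′ ⟩
      x′ k′ * q ∎
      where open ≡-Reasoning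
... | yes refl with i ≟ k
...   | yes refl = *-cancelʳ-≡ (x k) (x′ k) q (trans (sym at) (trans (y≗y′ k) at′))
...   | no i≢k   = trans (sym (same i i≢k)) (trans (y≗y′ i) (same′ i i≢k))

downward-induction : ∀ {n m} (P : ℕ → Set) → P m →
                     (∀ j → n ≤ j → j < m → P (suc j) → P j) →
                     ∀ j → n ≤ j → j ≤ m → P j
downward-induction {n} {m} P base step j n≤j j≤m = go (m ∸ j) j (m+[n∸m]≡n j≤m) n≤j
  where
    go : ∀ d j → j + d ≡ m → n ≤ j → P j
    go zero j j+0≡m _ = subst P (trans (sym j+0≡m) (+-identityʳ j)) base
    go (suc d) j j+1+d≡m n≤j =
      step j n≤j (subst (j <_) j+1+d≡m (m<m+n j z<s))
        (go d (suc j) (trans (sym (+-suc j d)) j+1+d≡m) (m≤n⇒m≤1+n n≤j))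

-- Throughout, α = a/b is square-free with a, b coprime, and p 0, …, p (N-1)
-- are the primes of a * b (with multiplicity, hence each exactly once).
module SquareFreeRational (a b : ℕ) (cop : Coprime a b)
  (sf-a : SquareFree a) (sf-b : SquareFree b) (N : ℕ) (p : ℕ → ℕ)
  (primes : ∀ i → i < N → Prime (p i)) (prod≡ab : prodTo p N ≡ a * b) where

  -- The primes of a * b are pairwise distinct, a * b being free of prime squares.
  distinct : ∀ {i j} → i < j → j < N → p i ≢ p j
  distinct i<j j<N = distinct-primes p N no-prime-square i<j j<N (primes _ j<N)
    where
      no-prime-square : ∀ {q} → Prime q → ¬ q * q ∣ prodTo p N
      no-prime-square q-prime rewrite prod≡ab = prime²∤coprime-product cop sf-a sf-b q-prime

  -- The new prime p j of α_{j+1} divides no numerator and no denominator of a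
  -- factorization of α_j, since it divides neither numerator nor
  -- denominator of α_j.
  new-prime∤num : ∀ {j s} → FactOf a b p j s → j < N → ∀ i → ¬ p j ∣ num s i
  new-prime∤num fs j<N i pj∣num =
    prime∤earlier-selection p N primes distinct _ (selects-if p (λ i → does (p i ∣? a))) j<N
      (prime∣num⇒∣ fs (primes _ j<N) pj∣num)

  new-prime∤den : ∀ {j s} → FactOf a b p j s → j < N → ∀ i → ¬ p j ∣ den s i
  new-prime∤den fs j<N i pj∣den =
    prime∤earlier-selection p N primes distinct _ (selects-if p (λ i → does (p i ∣? b))) j<N
      (prime∣den⇒∣ fs (primes _ j<N) pj∣den)

  -- The
  -- side that changes is fixed (p j divides a or b, not both), the unchanged
  -- side is read off from t, and the changed side by scaledAt-unique.
  directSub-unique : ∀ {j s s′ t t′} → j < N → DirectSub a b p j s t → DirectSub a b p j s′ t′ →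
                     t ≗ t′ → s ≗ s′
  directSub-unique j<N (fs , _ , inj₁ (_ , _ , den-same , num-scaled))
                       (_ , _ , inj₁ (_ , _ , den-same′ , num-scaled′)) t≗t′ i =
    cong₂ _,_
      (scaledAt-unique {{prime⇒nonZero (primes _ j<N)}} (new-prime∤num fs j<N)
         num-scaled num-scaled′ (cong proj₁ ∘ t≗t′) i)
      (trans (sym (den-same i)) (trans (cong proj₂ (t≗t′ i)) (den-same′ i)))
  directSub-unique j<N (fs , _ , inj₂ (_ , _ , num-same , den-scaled))
                       (_ , _ , inj₂ (_ , _ , num-same′ , den-scaled′)) t≗t′ i =
    cong₂ _,_
      (trans (sym (num-same i)) (trans (cong proj₁ (t≗t′ i)) (num-same′ i)))
      (scaledAt-unique {{prime⇒nonZero (primes _ j<N)}} (new-prime∤den fs j<N)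
         den-scaled den-scaled′ (cong proj₂ ∘ t≗t′) i)
  directSub-unique j<N (_ , _ , inj₁ (pj∣a , _)) (_ , _ , inj₂ (pj∣b , _)) _ =
    ⊥-elim (prime∤common (primes _ j<N) cop pj∣a pj∣b)
  directSub-unique j<N (_ , _ , inj₂ (pj∣b , _)) (_ , _ , inj₁ (pj∣a , _)) _ =
    ⊥-elim (prime∤common (primes _ j<N) cop pj∣a pj∣b)

  chains-agree : ∀ {n m A B C C′} → m ≤ N →
                 Chain a b p n m A B C → Chain a b p n m A B C′ →
                 ∀ j → n ≤ j → j ≤ m → C j ≗ C′ j
  chains-agree {C = C} {C′} m≤N (_ , top , steps) (_ , top′ , steps′) =
    downward-induction (λ j → C j ≗ C′ j) (λ i → trans (top i) (sym (top′ i)))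
      (λ j n≤j j<m → directSub-unique (<-≤-trans j<m m≤N) (steps j n≤j j<m) (steps′ j n≤j j<m))

lemma3p1 : (a b : ℕ) → 0 < a → 0 < b → Coprime a b → SquareFree a → SquareFree b →
    (N : ℕ) (p : ℕ → ℕ) →
    (∀ i → i < N → Prime (p i)) →
    (∀ i → suc i < N → p (suc i) ≤ p i) →
    prodTo p N ≡ a * b →
    (n m : ℕ) → n < m → m ≤ N →
    (A B : Seq) → FactOf a b p n A → FactOf a b p m B →
    SubFact a b p n m A B →
    Σ (ℕ → Seq) λ C → Chain a b p n m A B C
    × (∀ C′ → Chain a b p n m A B C′ →
    ∀ j → n < j → j < m → ∀ i → C j i ≡ C′ j i)
lemma3p1 a b _ _ cop sf-a sf-b N p primes _ prod≡ab n m _ m≤N A B _ _ (_ , C , chain) =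
  C , chain , λ C′ chain′ j n<j j<m →
    chains-agree m≤N chain chain′ j (<⇒≤ n<j) (<⇒≤ j<m)
  where open SquareFreeRational a b cop sf-a sf-b N p primes prod≡ab
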